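{- Let $T$ be a tree such that $\Delta(T)\le C_1$, all but $r$ vertices of $T$ have degree at most $C_2\le C_1$, and $|V(T)|\ge \ell$, for some $C_1,C_2,\ell,r>0$. Then there exist disjoint vertex sets $A_1,\dots,A_s\subseteq V(T)$ such that: $V(T)=\bigcup_{i=1}^s A_i$; $T[A_i]$ is connected for each $1\le i\le s$; $\ell\le |A_i|\le C_1\ell$ for each $1\le i\le r$; and $\ell\le |A_i|\le C_2\ell$ for each $r<i\le s$.
   Context: $\Delta(T)$ denotes the maximum degree of $T$, and $T[A]$ the subgraph of $T$ induced by $A$. -}

module Defs where

open import Data.Nat using (ℕ; _≤_; _<_; _<ᵇ_)
open import Data.Bool using (Bool; true; false)
open import Data.Fin using (Fin)
open import Data.Fin.Subset using (Subset; _∈_; ∣_∣)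
open import Data.Vec using (tabulate)
open import Data.List using (List; []; _∷_; _++_; [_]; length)
open import Data.List.Relation.Unary.Unique.Propositional using (Unique)
open import Data.Product using (Σ; _×_)
open import Relation.Binary.PropositionalEquality using (_≡_)
open import Relation.Nullary using (¬_)

record Graph (n : ℕ) : Set where
  field
    adj   : Fin n → Fin n → Bool
    sym   : ∀ u v → adj u v ≡ adj v u
    irrefl : ∀ v → adj v v ≡ false
open Graph public

module _ {n : ℕ} (G : Graph n) where

  N : Fin n → Subset n
  N v = tabulate (λ u → adj G v u)

  deg : Fin n → ℕ
  deg v = ∣ N v ∣

  HighDeg : ℕ → Subset n
  HighDeg c = tabulate (λ v → c <ᵇ deg v)

  MaxDeg≤ : ℕ → Set
  MaxDeg≤ c = ∀ v → deg v ≤ c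

  data WalkIn (A : Subset n) : Fin n → Fin n → Set where
    here : ∀ {u} → u ∈ A → WalkIn A u u
    step : ∀ {u w v} → u ∈ A → adj G u w ≡ true → WalkIn A w v → WalkIn A u v

  ConnectedIn : Subset n → Set
  ConnectedIn A = Σ (Fin n) (λ v → v ∈ A) × (∀ u v → u ∈ A → v ∈ A → WalkIn A u v)

  Chain : List (Fin n) → Set
  Chain [] = Data.Unit.⊤
    where import Data.Unit
  Chain (x ∷ []) = Data.Unit.⊤
    where import Data.Unit
  Chain (x ∷ y ∷ ys) = (adj G x y ≡ true) × Chain (y ∷ ys)

  IsCycle : List (Fin n) → Set
  IsCycle [] = Data.Empty.⊥
    where import Data.Empty
  IsCycle (u ∷ ws) = (3 ≤ length (u ∷ ws)) × Unique (u ∷ ws) × Chain (u ∷ ws ++ [ u ])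

  Acyclic : Set
  Acyclic = ∀ vs → ¬ IsCycle vs

  Connected : Set
  Connected = ConnectedIn Data.Fin.Subset.⊤

  IsTree : Set
  IsTree = Connected × Acyclic

-- Write ℓ = m + 1 and explore the graph depth first. Each vertex v returns to its parent a
-- residual: v together with the residuals of its children, a connected set rooted at v. Once
-- a residual exceeds m it is cut off as a piece with centre v; it has at most 1 + c·m vertices,
-- c the number of children of v. Below the root c ≤ deg v − 1, because of the edge to the
-- parent, so such a piece can still absorb a residual of at most m vertices and stays within
-- 1 + deg(v)·m ≤ C₁ℓ; this is how a residual left over at the root is disposed of, by merging
-- it into an adjacent piece. A piece with more than C₂ℓ vertices therefore has a centre of
-- degree > C₂; the pieces being disjoint, at most r of them are that large, and these are
-- listed first.

module Submission where

open import Defs hiding (sym)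
open import Data.Nat using (ℕ; suc; _+_; _*_; _≤_; _<_; z≤n; s≤s)
open import Data.Nat.Properties
open import Data.Bool using (Bool; true; false)
open import Data.Bool.Properties using (T-≡) renaming (_≟_ to _≟ᵇ_)
open import Data.Fin using (Fin; zero; suc; toℕ)
open import Data.Fin.Properties using (any?)
open import Data.Fin.Subset
open import Data.Fin.Subset.Properties
open import Data.Fin.Subset.Induction using (Acc; acc; ⊂-wellFounded)
open import Data.Vec using (tabulate; []; _∷_)
open import Data.Vec.Properties using (lookup⇒[]=; lookup∘tabulate)
open import Data.List using (List; []; _∷_; _++_; length; lookup; allFin; filter)
open import Data.List.Properties using (partition-defn)
open import Data.List.Relation.Unary.All as All using (All; []; _∷_)
import Data.List.Relation.Unary.All.Properties as AllP
open import Data.List.Relation.Unary.Any as Any using (Any; here; there)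
import Data.List.Relation.Unary.Any.Properties as AnyP
open import Data.List.Relation.Unary.AllPairs using (AllPairs; []; _∷_)
import Data.List.Relation.Unary.AllPairs.Properties as AllPairsP
open import Data.List.Membership.Propositional using () renaming (_∈_ to _∈ₗ_)
open import Data.List.Membership.Propositional.Properties using (∈-allFin; ∈-lookup)
import Data.List.Relation.Binary.Permutation.Setoid as Permutation
import Data.List.Relation.Binary.Permutation.Setoid.Properties as PermutationP
open import Data.Product using (Σ; _×_; _,_; proj₁; proj₂; ∃; ∃₂)
open import Data.Sum using (_⊎_; inj₁; inj₂; [_,_])
open import Function using (_∘_; Equivalence)
open import Relation.Binary.PropositionalEquality using (_≡_; _≢_; refl; sym; trans; cong; subst; setoid)
open import Relation.Nullary using (¬_; Dec; yes; no; ¬?; contradiction)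
open import Relation.Nullary.Decidable using (decidable-stable)
open import Relation.Unary using (Decidable)
open import Relation.Unary.Properties using (∁?)

∣p∪q∣≤∣p∣+∣q∣ : ∀ {n} (p q : Subset n) → ∣ p ∪ q ∣ ≤ ∣ p ∣ + ∣ q ∣
∣p∪q∣≤∣p∣+∣q∣ []          []          = z≤n
∣p∪q∣≤∣p∣+∣q∣ (true ∷ p)  (true ∷ q)  = s≤s (≤-trans (∣p∪q∣≤∣p∣+∣q∣ p q) (+-monoʳ-≤ ∣ p ∣ (n≤1+n ∣ q ∣)))
∣p∪q∣≤∣p∣+∣q∣ (true ∷ p)  (false ∷ q) = s≤s (∣p∪q∣≤∣p∣+∣q∣ p q)
∣p∪q∣≤∣p∣+∣q∣ (false ∷ p) (true ∷ q)  = ≤-trans (s≤s (∣p∪q∣≤∣p∣+∣q∣ p q)) (≤-reflexive (sym (+-suc ∣ p ∣ ∣ q ∣)))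
∣p∪q∣≤∣p∣+∣q∣ (false ∷ p) (false ∷ q) = ∣p∪q∣≤∣p∣+∣q∣ p q

x∈tabulate : ∀ {n} {f : Fin n → Bool} {x} → f x ≡ true → x ∈ tabulate f
x∈tabulate {f = f} {x} fx = lookup⇒[]= x (tabulate f) (trans (lookup∘tabulate f x) fx)

x∈p∩∁q⇒x∉q : ∀ {n} {x : Fin n} {p q} → x ∈ p ∩ ∁ q → x ∉ q
x∈p∩∁q⇒x∉q {p = p} {q} = x∈∁p⇒x∉p ∘ proj₂ ∘ x∈p∩q⁻ p (∁ q)

AllPairs-lookup : ∀ {A : Set} {R : A → A → Set} → (∀ {x y} → R x y → R y x) →
                  ∀ {xs} → AllPairs R xs → ∀ i j → i ≢ j → R (lookup xs i) (lookup xs j)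
AllPairs-lookup R-sym (_ ∷ _)      zero    zero    i≢j = contradiction refl i≢j
AllPairs-lookup R-sym (Rx ∷ _)     zero    (suc j) _   = All.lookup Rx (∈-lookup j)
AllPairs-lookup R-sym (Rx ∷ _)     (suc i) zero    _   = R-sym (All.lookup Rx (∈-lookup i))
AllPairs-lookup R-sym (_ ∷ Rxs)    (suc i) (suc j) i≢j = AllPairs-lookup R-sym Rxs i j (i≢j ∘ cong suc)

All-lookup-++ʳ : ∀ {A : Set} {P : A → Set} xs {ys} → All P ys →
                 ∀ i → length xs ≤ toℕ i → P (lookup (xs ++ ys) i)
All-lookup-++ʳ []       Pys i       _       = All.lookup Pys (∈-lookup i)
All-lookup-++ʳ (x ∷ xs) Pys zero    ()
All-lookup-++ʳ (x ∷ xs) Pys (suc i) (s≤s l) = All-lookup-++ʳ xs Pys i l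

≤suc[c*m]⇒+m≤suc[c′*m] : ∀ {a c c′} m → a ≤ suc (c * m) → c < c′ → a + m ≤ suc (c′ * m)
≤suc[c*m]⇒+m≤suc[c′*m] {a} {c} {c′} m a≤ c<c′ = begin
  a + m           ≤⟨ +-monoˡ-≤ m a≤ ⟩
  suc (c * m + m) ≡⟨ cong suc (+-comm (c * m) m) ⟩
  suc (suc c * m) ≤⟨ s≤s (*-monoˡ-≤ m c<c′) ⟩
  suc (c′ * m)    ∎
  where open ≤-Reasoning

suc[c*m]≤c*[1+m] : ∀ {c} m → 0 < c → suc (c * m) ≤ c * suc m
suc[c*m]≤c*[1+m] {suc c} m _ = s≤s (+-monoʳ-≤ m (*-monoʳ-≤ c (n≤1+n m)))

module _ {n : ℕ} where

  open Permutation (setoid (Subset n)) using (_↭_; ↭-prep; ↭-trans; ↭-swap; ↭-refl)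
  open PermutationP (setoid (Subset n)) using (All-resp-↭; Any-resp-↭; AllPairs-resp-↭; partition-↭; ↭-shift)

  Disjoint : Subset n → Subset n → Set
  Disjoint A B = ∀ x → x ∈ A → x ∉ B

  Disjoint-sym : ∀ {A B : Subset n} → Disjoint A B → Disjoint B A
  Disjoint-sym A#B x x∈B x∈A = A#B x x∈A x∈B

  ∪-disjoint : ∀ {A B C : Subset n} → Disjoint A C → Disjoint B C → Disjoint (A ∪ B) C
  ∪-disjoint {A} {B} A#C B#C x x∈A∪B = [ A#C x , B#C x ] (x∈p∪q⁻ A B x∈A∪B)

  ∪-⊆ : ∀ {A B C : Subset n} → A ⊆ C → B ⊆ C → A ∪ B ⊆ C
  ∪-⊆ {A} {B} A⊆C B⊆C x∈A∪B = [ A⊆C , B⊆C ] (x∈p∪q⁻ A B x∈A∪B)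

  disjoint-meeting-count : ∀ H {Bs} → AllPairs Disjoint Bs → All (λ B → Nonempty (H ∩ B)) Bs →
                           length Bs ≤ ∣ H ∣
  disjoint-meeting-count H []         []          = z≤n
  disjoint-meeting-count H {B ∷ _} (B#Bs ∷ #Bs) (H∩B≢∅ ∷ meets) =
    ≤-trans (s≤s (disjoint-meeting-count (H ─ B) #Bs (All.zipWith meets-rest (B#Bs , meets))))
            (p∩q≢∅⇒∣p─q∣<∣p∣ H B H∩B≢∅)
    where
    meets-rest : ∀ {C} → Disjoint B C × Nonempty (H ∩ C) → Nonempty ((H ─ B) ∩ C)
    meets-rest {C} (B#C , x , x∈H∩C) with x∈p∩q⁻ H C x∈H∩C
    ... | x∈H , x∈C = x , x∈p∩q⁺ (x∈p∧x∉q⇒x∈p─q x∈H (λ x∈B → B#C x x∈B x∈C) , x∈C)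

  record Partition (E : Subset n) (Bs : List (Subset n)) : Set where
    field
      disjoint : AllPairs Disjoint Bs
      within   : All (_⊆ E) Bs
      covers   : ∀ {x} → x ∈ E → Any (x ∈_) Bs
  open Partition

  Partition-resp-↭ : ∀ {E Bs Cs} → Partition E Bs → Bs ↭ Cs → Partition E Cs
  Partition-resp-↭ π Bs↭Cs = record
    { disjoint = AllPairs-resp-↭ Disjoint-sym ((λ { refl d → d }) , (λ { refl d → d })) Bs↭Cs (disjoint π)
    ; within   = All-resp-↭ (λ { refl B⊆E → B⊆E }) Bs↭Cs (within π)
    ; covers   = λ x∈E → Any-resp-↭ (λ { refl x∈B → x∈B }) Bs↭Cs (covers π x∈E)
    }

  partition-⁅⁆ : ∀ v → Partition ⁅ v ⁆ (⁅ v ⁆ ∷ [])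
  partition-⁅⁆ v = record { disjoint = [] ∷ [] ; within = (λ x∈v → x∈v) ∷ [] ; covers = here }

  partition-⊥ : ∀ {E Bs} → Partition E Bs → Partition E (⊥ ∷ Bs)
  partition-⊥ π = record
    { disjoint = All.tabulate (λ _ _ x∈⊥ → contradiction x∈⊥ ∉⊥) ∷ disjoint π
    ; within   = ⊥⊆ ∷ within π
    ; covers   = there ∘ covers π
    }

  partition-⊤ : ∀ {E Bs} → (∀ {x} → x ∈ E) → Partition E Bs → Partition ⊤ Bs
  partition-⊤ E-full π = record
    { disjoint = disjoint π
    ; within   = All.map (λ _ {x} _ → ∈⊤) (within π)
    ; covers   = λ _ → covers π E-full
    }

  partition-++ : ∀ {E F Bs Cs} → Disjoint E F → Partition E Bs → Partition F Cs → Partition (E ∪ F) (Bs ++ Cs)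
  partition-++ {E} {F} E#F π ρ = record
    { disjoint = AllPairsP.++⁺ (disjoint π) (disjoint ρ)
        (All.map (λ B⊆E → All.map (λ C⊆F x x∈B x∈C → E#F x (B⊆E x∈B) (C⊆F x∈C)) (within ρ)) (within π))
    ; within   = AllP.++⁺ (All.map (λ B⊆E {x} x∈B → p⊆p∪q F (B⊆E x∈B)) (within π))
                          (All.map (λ C⊆F {x} x∈C → q⊆p∪q E F (C⊆F x∈C)) (within ρ))
    ; covers   = λ x∈E∪F → [ AnyP.++⁺ˡ ∘ covers π , AnyP.++⁺ʳ _ ∘ covers ρ ] (x∈p∪q⁻ E F x∈E∪F)
    }

  partition-merge : ∀ {E B C Bs} → Partition E (B ∷ C ∷ Bs) → Partition E (B ∪ C ∷ Bs)
  partition-merge {E} {B} {C} {Bs} π with disjoint π | within π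
  ... | (_ ∷ B#Bs) ∷ C#Bs ∷ #Bs | B⊆E ∷ C⊆E ∷ Bs⊆E = record
    { disjoint = All.zipWith (λ (B#D , C#D) → ∪-disjoint B#D C#D) (B#Bs , C#Bs) ∷ #Bs
    ; within   = ∪-⊆ B⊆E C⊆E ∷ Bs⊆E
    ; covers   = merged ∘ covers π
    }
    where
    merged : ∀ {x} → Any (x ∈_) (B ∷ C ∷ Bs) → Any (x ∈_) (B ∪ C ∷ Bs)
    merged (here x∈B)         = here (p⊆p∪q C x∈B)
    merged (there (here x∈C)) = here (q⊆p∪q B C x∈C)
    merged (there (there x∈)) = there x∈

  partition-join : ∀ {E F B C Bs Cs} → Disjoint E F → Partition E (B ∷ Bs) → Partition F (C ∷ Cs) →
                   Partition (E ∪ F) (B ∪ C ∷ Bs ++ Cs)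
  partition-join {B = B} {C} {Bs} {Cs} E#F π ρ =
    partition-merge (Partition-resp-↭ (partition-++ E#F π ρ) (↭-prep B (↭-shift Bs Cs)))

  partition-split-by : ∀ {P : Subset n → Set} (P? : Decidable P) {E} Bs → Partition E Bs →
                        Partition E (filter P? Bs ++ filter (∁? P?) Bs)
  partition-split-by P? Bs π = Partition-resp-↭ π
    (subst (λ split → Bs ↭ proj₁ split ++ proj₂ split) (partition-defn P? Bs) (partition-↭ P? Bs))

  outside-point : ∀ {R : Subset n} → ∣ R ∣ < n → ∃ λ x → x ∉ R
  outside-point {R} ∣R∣<n with any? (λ x → ¬? (x ∈? R))
  ... | yes x∉R  = x∉R
  ... | no  ∄x∉R = contradiction (p⊆q⇒∣p∣≤∣q∣ ⊤⊆R) (<⇒≱ (subst (∣ R ∣ <_) (sym (∣⊤∣≡n n)) ∣R∣<n))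
    where
    ⊤⊆R : ⊤ ⊆ R
    ⊤⊆R {x} _ = decidable-stable (x ∈? R) (λ x∉R → ∄x∉R (x , x∉R))

  pull-to-front : ∀ {Q : Subset n → Set} {Bs} → Any Q Bs → ∃₂ λ B rest → Q B × Bs ↭ B ∷ rest
  pull-to-front (here QB) = _ , _ , QB , ↭-refl
  pull-to-front (there QB∈Bs) with pull-to-front QB∈Bs
  ... | B , rest , QB , Bs↭ = B , _ ∷ rest , QB , ↭-trans (↭-prep _ Bs↭) (↭-swap _ _ ↭-refl)

open Partition

module _ {n : ℕ} (G : Graph n) where
  open Permutation (setoid (Subset n)) using (_↭_; ↭-prep)
  open PermutationP (setoid (Subset n)) using (All-resp-↭)

  infix 4 _~_
  _~_ : Fin n → Fin n → Set
  u ~ v = adj G u v ≡ true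

  _~?_ : ∀ u v → Dec (u ~ v)
  u ~? v = adj G u v ≟ᵇ true

  ~-sym : ∀ {u v} → u ~ v → v ~ u
  ~-sym {u} {v} u~v = trans (Graph.sym G v u) u~v

  ~⇒∈N : ∀ {u v} → u ~ v → v ∈ N G u
  ~⇒∈N = x∈tabulate

  walk-source : ∀ {A u v} → WalkIn G A u v → u ∈ A
  walk-source (here u∈A)     = u∈A
  walk-source (step u∈A _ _) = u∈A

  walk-mono : ∀ {A B u v} → A ⊆ B → WalkIn G A u v → WalkIn G B u v
  walk-mono A⊆B (here u∈A)         = here (A⊆B u∈A)
  walk-mono A⊆B (step u∈A u~w w→v) = step (A⊆B u∈A) u~w (walk-mono A⊆B w→v)

  infixr 5 _◅◅_
  _◅◅_ : ∀ {A u v w} → WalkIn G A u v → WalkIn G A v w → WalkIn G A u w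
  here _           ◅◅ v→w = v→w
  step u∈A u~x x→v ◅◅ v→w = step u∈A u~x (x→v ◅◅ v→w)

  walk-reverse : ∀ {A u v} → WalkIn G A u v → WalkIn G A v u
  walk-reverse (here u∈A)         = here u∈A
  walk-reverse (step u∈A u~w w→v) = walk-reverse w→v ◅◅ step (walk-source w→v) (~-sym u~w) (here u∈A)

  walk-exit : ∀ {A B u v} → WalkIn G B u v → u ∈ A → v ∉ A → ∃₂ λ a b → a ∈ A × b ∉ A × a ~ b
  walk-exit (here _) u∈A v∉A = contradiction u∈A v∉A
  walk-exit {A} (step {u} {w} _ u~w w→v) u∈A v∉A with w ∈? A
  ... | yes w∈A = walk-exit w→v w∈A v∉A
  ... | no  w∉A = u , w , u∈A , w∉A , u~w

  walk-closed : ∀ {U E u v} → (∀ {x y} → x ∈ E → y ∈ U → x ~ y → y ∈ E) → WalkIn G U u v → u ∈ E → v ∈ E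
  walk-closed closed (here _)         u∈E = u∈E
  walk-closed closed (step _ u~w w→v) u∈E = walk-closed closed w→v (closed u∈E (walk-source w→v) u~w)

  Rooted : Subset n → Fin n → Set
  Rooted A v = ∀ {x} → x ∈ A → WalkIn G A v x

  rooted-∪ : ∀ {A B v w} → v ∈ A → Rooted A v → v ~ w → Rooted B w → Rooted (A ∪ B) v
  rooted-∪ {A} {B} v∈A A-rooted v~w B-rooted x∈A∪B with x∈p∪q⁻ A B x∈A∪B
  ... | inj₁ x∈A = walk-mono (p⊆p∪q B) (A-rooted x∈A)
  ... | inj₂ x∈B = step (p⊆p∪q B v∈A) v~w (walk-mono (q⊆p∪q A B) (B-rooted x∈B))

  rooted⇒connected : ∀ {A v} → v ∈ A → Rooted A v → ConnectedIn G A
  rooted⇒connected v∈A rooted = (_ , v∈A) , λ _ _ x∈A y∈A → walk-reverse (rooted x∈A) ◅◅ rooted y∈A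

  connected⇒rooted : ∀ {A v} → ConnectedIn G A → v ∈ A → Rooted A v
  connected⇒rooted (_ , walk) v∈A x∈A = walk _ _ v∈A x∈A

  connected-∪ : ∀ {A B a b} → ConnectedIn G A → ConnectedIn G B → a ∈ A → b ∈ B → a ~ b → ConnectedIn G (A ∪ B)
  connected-∪ {A} {B} A-conn B-conn a∈A b∈B a~b =
    rooted⇒connected (p⊆p∪q B a∈A) (rooted-∪ a∈A (connected⇒rooted A-conn a∈A) a~b (connected⇒rooted B-conn b∈B))

  Exit : Subset n → Fin n → Set
  Exit U v = ∃ λ p → p ∉ U × v ~ p

  adjacent-block : Connected G → ∀ {R Bs} → Partition ⊤ (R ∷ Bs) → Nonempty R → ∣ R ∣ < n →
                   ∃₂ λ B rest → Bs ↭ B ∷ rest × ∃₂ λ a b → a ∈ R × b ∈ B × a ~ b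
  adjacent-block (_ , walk) π (r , r∈R) ∣R∣<n with outside-point ∣R∣<n
  ... | x , x∉R with walk-exit (walk r x ∈⊤ ∈⊤) r∈R x∉R
  ... | a , b , a∈R , b∉R , a~b with covers π (∈⊤ {x = b})
  ... | here b∈R   = contradiction b∈R b∉R
  ... | there b∈Bs with pull-to-front b∈Bs
  ... | B , rest , b∈B , Bs↭ = B , rest , Bs↭ , a , b , a∈R , b∈B , a~b

  module _ (m : ℕ) where

    -- With slack m, P can still absorb a connected set of at most m vertices next to it.
    record Piece (slack : ℕ) (P : Subset n) : Set where
      field
        connected : ConnectedIn G P
        large     : suc m ≤ ∣ P ∣
        centre    : Fin n
        centre∈P  : centre ∈ P
        bounded   : ∣ P ∣ + slack ≤ suc (deg G centre * m)

    piece-forget-slack : ∀ {slack P} → Piece slack P → Piece 0 P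
    piece-forget-slack {slack} {P} p = record
      { connected = connected ; large = large ; centre = centre ; centre∈P = centre∈P
      ; bounded = ≤-trans (+-monoʳ-≤ ∣ P ∣ z≤n) bounded }
      where open Piece p

    piece-size : ∀ {slack P c} → (p : Piece slack P) → deg G (Piece.centre p) ≤ c → 0 < c → ∣ P ∣ ≤ c * suc m
    piece-size {slack} {P} {c} p deg≤c 0<c = begin
      ∣ P ∣                            ≤⟨ m≤m+n ∣ P ∣ slack ⟩
      ∣ P ∣ + slack                    ≤⟨ Piece.bounded p ⟩
      suc (deg G (Piece.centre p) * m) ≤⟨ s≤s (*-monoˡ-≤ m deg≤c) ⟩
      suc (c * m)                      ≤⟨ suc[c*m]≤c*[1+m] m 0<c ⟩
      c * suc m                        ∎
      where open ≤-Reasoning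

    absorb : ∀ {R P a b} → Piece m P → ConnectedIn G R → ∣ R ∣ ≤ m → a ∈ R → b ∈ P → a ~ b → Piece 0 (R ∪ P)
    absorb {R} {P} p R-conn R≤m a∈R b∈P a~b = record
      { connected = connected-∪ R-conn connected a∈R b∈P a~b
      ; large     = ≤-trans large (∣q∣≤∣p∪q∣ R P)
      ; centre    = centre
      ; centre∈P  = q⊆p∪q R P centre∈P
      ; bounded   = begin
          ∣ R ∪ P ∣ + 0    ≡⟨ +-identityʳ _ ⟩
          ∣ R ∪ P ∣        ≤⟨ ∣p∪q∣≤∣p∣+∣q∣ R P ⟩
          ∣ R ∣ + ∣ P ∣    ≤⟨ +-monoˡ-≤ ∣ P ∣ R≤m ⟩
          m + ∣ P ∣        ≡⟨ +-comm m ∣ P ∣ ⟩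
          ∣ P ∣ + m        ≤⟨ bounded ⟩
          suc (deg G centre * m) ∎
      }
      where open Piece p
            open ≤-Reasoning

    centre∈HighDeg : ∀ {slack P c} (p : Piece slack P) → 0 < c → c * suc m < ∣ P ∣ → Piece.centre p ∈ HighDeg G c
    centre∈HighDeg {c = c} p 0<c large with c <? deg G (Piece.centre p)
    ... | yes c<deg = x∈tabulate (Equivalence.to T-≡ (<⇒<ᵇ c<deg))
    ... | no  c≮deg = contradiction (piece-size p (≮⇒≥ c≮deg) 0<c) (<⇒≱ large)

    few-large-pieces : ∀ {c Bs} → 0 < c → AllPairs Disjoint Bs → All (Piece 0) Bs →
                       All (λ P → c * suc m < ∣ P ∣) Bs → length Bs ≤ ∣ HighDeg G c ∣
    few-large-pieces {c} 0<c disjoint pieces large = disjoint-meeting-count (HighDeg G c) disjoint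
      (All.zipWith (λ (p , big) → Piece.centre p , x∈p∩q⁺ (centre∈HighDeg p 0<c big , Piece.centre∈P p)) (pieces , large))

    -- The residual R is empty when the residual at v has just been cut off as a piece.
    record Explored (U : Subset n) (v : Fin n) : Set where
      field
        S         : Subset n
        S⊆U       : S ⊆ U
        v∈S       : v ∈ S
        S-closed  : ∀ {x y} → x ∈ S → y ∈ U → x ~ y → y ∈ S
        R         : Subset n
        Ps        : List (Subset n)
        partition : Partition S (R ∷ Ps)
        R-rooted  : Rooted R v
        R-small   : ∣ R ∣ ≤ m
        pieces    : All (Piece m) Ps

    module Search {U : Subset n} {v : Fin n} (v∈U : v ∈ U)
                  (explore-inside : ∀ {W w} → W ⊂ U → w ∈ W → Exit W w → Explored W w) where

      -- E is explored so far; R consists of v and the residuals of the children of v in E,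
      -- which are counted by ∣ N G v ∩ E ∣.
      record Frontier : Set where
        field
          E         : Subset n
          E⊆U       : E ⊆ U
          R         : Subset n
          Ps        : List (Subset n)
          partition : Partition E (R ∷ Ps)
          v∈R       : v ∈ R
          R-rooted  : Rooted R v
          R-bounded : ∣ R ∣ ≤ suc (∣ N G v ∩ E ∣ * m)
          pieces    : All (Piece m) Ps

        v∈E : v ∈ E
        v∈E = All.head (within partition) v∈R

      ClosedUpTo : List (Fin n) → Subset n → Set
      ClosedUpTo todo E = ∀ {x y} → x ∈ E → y ∈ U → x ~ y → y ∈ E ⊎ (x ≡ v × y ∈ₗ todo)

      Stage : List (Fin n) → Set
      Stage todo = Σ Frontier λ F → ClosedUpTo todo (Frontier.E F)

      closed-[] : ∀ {E} → ClosedUpTo [] E → ∀ {x y} → x ∈ E → y ∈ U → x ~ y → y ∈ E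
      closed-[] closed x∈E y∈U x~y = [ (λ y∈E → y∈E) , (λ { (_ , ()) }) ] (closed x∈E y∈U x~y)

      start : Stage (allFin n)
      start = F , λ x∈v _ _ → inj₂ (x∈⁅y⁆⇒x≡y v x∈v , ∈-allFin _)
        where
        F : Frontier
        F = record
          { E         = ⁅ v ⁆
          ; E⊆U       = λ x∈v → subst (_∈ U) (sym (x∈⁅y⁆⇒x≡y v x∈v)) v∈U
          ; R         = ⁅ v ⁆
          ; Ps        = []
          ; partition = partition-⁅⁆ v
          ; v∈R       = x∈⁅x⁆ v
          ; R-rooted  = λ x∈v → subst (WalkIn G ⁅ v ⁆ v) (sym (x∈⁅y⁆⇒x≡y v x∈v)) (here (x∈⁅x⁆ v))
          ; R-bounded = ≤-trans (≤-reflexive (∣⁅x⁆∣≡1 v)) (s≤s z≤n)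
          ; pieces    = []
          }

      skip : ∀ {w todo} (st : Stage (w ∷ todo)) → (w ∈ U ∩ ∁ (Frontier.E (proj₁ st)) → ¬ v ~ w) → Stage todo
      skip {w} {todo} (F , closed) fresh⇒≁ = F , closed′
        where
        open Frontier F
        closed′ : ClosedUpTo todo E
        closed′ x∈E y∈U x~y with closed x∈E y∈U x~y
        ... | inj₁ y∈E                  = inj₁ y∈E
        ... | inj₂ (x≡v , there y∈todo) = inj₂ (x≡v , y∈todo)
        ... | inj₂ (refl , here refl) with w ∈? E
        ...   | yes w∈E = inj₁ w∈E
        ...   | no  w∉E = contradiction x~y (fresh⇒≁ (x∈p∩q⁺ (y∈U , x∉p⇒x∈∁p w∉E)))

      extend : ∀ {w todo} (st : Stage (w ∷ todo)) → v ~ w → Explored (U ∩ ∁ (Frontier.E (proj₁ st))) w → Stage todo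
      extend {w} {todo} (F , closed) v~w C = F′ , closed′
        where
        open Frontier F
        module C = Explored C

        E#S : Disjoint E C.S
        E#S x x∈E x∈S = x∈p∩∁q⇒x∉q (C.S⊆U x∈S) x∈E

        more-children : ∣ N G v ∩ E ∣ < ∣ N G v ∩ (E ∪ C.S) ∣
        more-children = p⊂q⇒∣p∣<∣q∣
          ( (λ x∈N∩E → let x∈N , x∈E = x∈p∩q⁻ (N G v) E x∈N∩E in x∈p∩q⁺ (x∈N , p⊆p∪q C.S x∈E))
          , w , x∈p∩q⁺ (~⇒∈N v~w , q⊆p∪q E C.S C.v∈S)
          , λ w∈N∩E → E#S w (proj₂ (x∈p∩q⁻ (N G v) E w∈N∩E)) C.v∈S )

        F′ : Frontier
        F′ = record
          { E         = E ∪ C.S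
          ; E⊆U       = ∪-⊆ E⊆U (λ x∈S → p∩q⊆p U (∁ E) (C.S⊆U x∈S))
          ; R         = R ∪ C.R
          ; Ps        = Ps ++ C.Ps
          ; partition = partition-join E#S partition C.partition
          ; v∈R       = p⊆p∪q C.R v∈R
          ; R-rooted  = rooted-∪ v∈R R-rooted v~w C.R-rooted
          ; R-bounded = begin
              ∣ R ∪ C.R ∣     ≤⟨ ∣p∪q∣≤∣p∣+∣q∣ R C.R ⟩
              ∣ R ∣ + ∣ C.R ∣ ≤⟨ +-monoʳ-≤ ∣ R ∣ C.R-small ⟩
              ∣ R ∣ + m       ≤⟨ ≤suc[c*m]⇒+m≤suc[c′*m] m R-bounded more-children ⟩
              suc (∣ N G v ∩ (E ∪ C.S) ∣ * m) ∎
          ; pieces    = AllP.++⁺ pieces C.pieces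
          }
          where open ≤-Reasoning

        from-E : ∀ {x y} → x ∈ E → y ∈ U → x ~ y → y ∈ E ∪ C.S ⊎ (x ≡ v × y ∈ₗ todo)
        from-E x∈E y∈U x~y with closed x∈E y∈U x~y
        ... | inj₁ y∈E                  = inj₁ (p⊆p∪q C.S y∈E)
        ... | inj₂ (_ , here refl)      = inj₁ (q⊆p∪q E C.S C.v∈S)
        ... | inj₂ (x≡v , there y∈todo) = inj₂ (x≡v , y∈todo)

        from-S : ∀ {x y} → x ∈ C.S → y ∈ U → x ~ y → y ∈ E ∪ C.S
        from-S {y = y} x∈S y∈U x~y with y ∈? E
        ... | yes y∈E = p⊆p∪q C.S y∈E
        ... | no  y∉E = q⊆p∪q E C.S (C.S-closed x∈S (x∈p∩q⁺ (y∈U , x∉p⇒x∈∁p y∉E)) x~y)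

        closed′ : ClosedUpTo todo (E ∪ C.S)
        closed′ x∈E∪S y∈U x~y =
          [ (λ x∈E → from-E x∈E y∈U x~y) , (λ x∈S → inj₁ (from-S x∈S y∈U x~y)) ] (x∈p∪q⁻ E C.S x∈E∪S)

      run : ∀ todo → Stage todo → Stage []
      run []         st = st
      run (w ∷ todo) st with v ~? w | w ∈? U ∩ ∁ (Frontier.E (proj₁ st))
      ... | yes v~w | yes w-new = run todo (extend st v~w (explore-inside rest⊂U w-new (v , v∉rest , ~-sym v~w)))
        where
        open Frontier (proj₁ st)
        v∉rest : v ∉ U ∩ ∁ E
        v∉rest v∈rest = x∈p∩∁q⇒x∉q v∈rest v∈E
        rest⊂U : U ∩ ∁ E ⊂ U
        rest⊂U = p∩q⊆p U (∁ E) , v , v∈U , v∉rest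
      ... | yes _   | no w-old  = run todo (skip st (λ w-new _ → w-old w-new))
      ... | no v≁w  | _         = run todo (skip st (λ _ → v≁w))

      final : Stage []
      final = run (allFin n) start

      finish : Exit U v → Explored U v
      finish (p , p∉U , v~p) = settle (∣ R ∣ ≤? m)
        where
        open Frontier (proj₁ final)

        fewer-children : ∣ N G v ∩ E ∣ < deg G v
        fewer-children = p⊂q⇒∣p∣<∣q∣
          (p∩q⊆p (N G v) E , p , ~⇒∈N v~p , λ p∈N∩E → p∉U (E⊆U (proj₂ (x∈p∩q⁻ (N G v) E p∈N∩E))))

        settle : Dec (∣ R ∣ ≤ m) → Explored U v
        settle (yes R≤m) = record
          { S = E ; S⊆U = E⊆U ; v∈S = v∈E ; S-closed = closed-[] (proj₂ final)
          ; R = R ; Ps = Ps ; partition = partition ; R-rooted = R-rooted ; R-small = R≤m ; pieces = pieces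
          }
        settle (no R≰m) = record
          { S = E ; S⊆U = E⊆U ; v∈S = v∈E ; S-closed = closed-[] (proj₂ final)
          ; R = ⊥ ; Ps = R ∷ Ps ; partition = partition-⊥ partition
          ; R-rooted = λ x∈⊥ → contradiction x∈⊥ ∉⊥
          ; R-small = ≤-trans (≤-reflexive (∣⊥∣≡0 n)) z≤n
          ; pieces = R-piece ∷ pieces
          }
          where
          R-piece : Piece m R
          R-piece = record
            { connected = rooted⇒connected v∈R R-rooted ; large = ≰⇒> R≰m ; centre = v ; centre∈P = v∈R
            ; bounded = ≤suc[c*m]⇒+m≤suc[c′*m] m R-bounded fewer-children }

    explore : ∀ {U} → Acc _⊂_ U → ∀ {v} → v ∈ U → Exit U v → Explored U v
    explore (acc below) v∈U = Search.finish v∈U (λ W⊂U → explore (below W⊂U))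

    partition-into-pieces : Connected G → suc m ≤ n → ∃ λ Bs → Partition ⊤ Bs × All (Piece 0) Bs
    partition-into-pieces connected@((ρ , _) , walk) ℓ≤n = settle (m <? ∣ R ∣)
      where
      open Search (∈⊤ {x = ρ}) (λ {W} _ → explore (⊂-wellFounded W))
      open Frontier (proj₁ final)

      everything : ∀ {x} → x ∈ E
      everything = walk-closed (closed-[] (proj₂ final)) (walk ρ _ ∈⊤ ∈⊤) v∈E

      π : Partition ⊤ (R ∷ Ps)
      π = partition-⊤ everything partition

      settle : Dec (m < ∣ R ∣) → ∃ λ Bs → Partition ⊤ Bs × All (Piece 0) Bs
      settle (yes m<R) = R ∷ Ps , π , R-piece ∷ All.map piece-forget-slack pieces
        where
        R-piece : Piece 0 R
        R-piece = record
          { connected = rooted⇒connected v∈R R-rooted ; large = m<R ; centre = ρ ; centre∈P = v∈R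
          ; bounded = ≤-trans (≤-reflexive (+-identityʳ ∣ R ∣))
                        (≤-trans R-bounded (s≤s (*-monoˡ-≤ m (∣p∩q∣≤∣p∣ (N G ρ) E)))) }
      settle (no m≮R) with adjacent-block connected π (ρ , v∈R) (≤-<-trans (≮⇒≥ m≮R) ℓ≤n)
      ... | P , rest , Ps↭ , a , b , a∈R , b∈P , a~b with All-resp-↭ (λ { refl p → p }) Ps↭ pieces
      ... | P-piece ∷ rest-pieces =
        R ∪ P ∷ rest ,
        partition-merge (Partition-resp-↭ π (↭-prep R Ps↭)) ,
        absorb P-piece (rooted⇒connected v∈R R-rooted) (≮⇒≥ m≮R) a∈R b∈P a~b ∷
        All.map piece-forget-slack rest-pieces

lemma2p1 : (n : ℕ) (T : Graph n) → IsTree T →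
    (C₁ C₂ ℓ r : ℕ) → 0 < C₁ → 0 < C₂ → 0 < ℓ → 0 < r →
    C₂ ≤ C₁ → MaxDeg≤ T C₁ → ∣ HighDeg T C₂ ∣ ≤ r → ℓ ≤ n →
    Σ ℕ (λ s → Σ (Fin s → Subset n) (λ A →
      (∀ i j → i ≢ j → ∀ v → ¬ (v ∈ A i × v ∈ A j)) ×
      (∀ v → ∃ (λ i → v ∈ A i)) ×
      (∀ i → ConnectedIn T (A i)) ×
      (∀ i → toℕ i < r → ℓ ≤ ∣ A i ∣ × ∣ A i ∣ ≤ C₁ * ℓ) ×
      (∀ i → r ≤ toℕ i → ℓ ≤ ∣ A i ∣ × ∣ A i ∣ ≤ C₂ * ℓ)))
lemma2p1 n T (connected , _) C₁ C₂ (suc m) r 0<C₁ 0<C₂ _ _ _ Δ≤C₁ high≤r ℓ≤n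
  with partition-into-pieces T m connected ℓ≤n
... | Bs , π , pieces =
  length Cs , lookup Cs ,
  (λ i j i≢j v (v∈i , v∈j) → AllPairs-lookup Disjoint-sym (disjoint π′) i j i≢j v v∈i v∈j) ,
  (λ v → let v∈Cs = covers π′ (∈⊤ {x = v}) in Any.index v∈Cs , AnyP.lookup-index v∈Cs) ,
  (λ i → Piece.connected (piece i)) ,
  (λ i _ → Piece.large (piece i) , piece-size T m (piece i) (Δ≤C₁ _) 0<C₁) ,
  (λ i r≤i → Piece.large (piece i) ,
     ≮⇒≥ (All-lookup-++ʳ larges (AllP.all-filter (∁? large?) Bs) i (≤-trans few-large r≤i)))
  where
  large? : Decidable (λ P → C₂ * suc m < ∣ P ∣)
  large? P = C₂ * suc m <? ∣ P ∣
  larges Cs : List (Subset n)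
  larges = filter large? Bs
  Cs = larges ++ filter (∁? large?) Bs
  π′ : Partition ⊤ Cs
  π′ = partition-split-by large? Bs π
  piece : ∀ i → Piece T m 0 (lookup Cs i)
  piece i = All.lookup (AllP.++⁺ (AllP.filter⁺ large? pieces) (AllP.filter⁺ (∁? large?) pieces)) (∈-lookup i)
  few-large : length larges ≤ r
  few-large = ≤-trans (few-large-pieces T m 0<C₂ (AllPairsP.filter⁺ large? (disjoint π))
                         (AllP.filter⁺ large? pieces) (AllP.all-filter large? Bs)) high≤r
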